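{- Let $\mathcal{V}$ be a symmetric monoidal category, $\Gamma$ a groupoid and $A:\Gamma\to\mathbf{Gpd}$ a functor. Let $C,\Xi:\Gamma.A^{\to}\to\mathcal{V}$ be functors, let $M,N:\Gamma\to\Gamma.A$ be sections of the projection $\Gamma.A\to\Gamma$, let $\hat P:\Gamma\to\Gamma.A^{\to}$ be a section of the projection $\Gamma.A^\to\to\Gamma$ whose composites with the source and target functors $\Gamma.A^\to\to\Gamma.A$ are $M$ and $N$ respectively, and let $c:\Xi\circ r_A\Rightarrow C\circ r_A$ be a natural transformation. Then there exists a natural transformation $\hat c_{[M,N,P]}:\Xi\circ\hat P\Rightarrow C\circ\hat P$ such that, when $N=M$ and $\hat P = r_A\circ M$ (i.e. $P$ is reflexivity), $\hat c_{[M,M,\mathrm{refl}]} = c\circ M$ (whiskering).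
   Context: For a groupoid $\Gamma$ and functor $A:\Gamma\to\mathbf{Gpd}$, the Grothendieck construction $\Gamma.A$ is the groupoid whose objects are pairs $(\gamma,a)$ with $\gamma\in\Gamma$, $a\in A(\gamma)$, and whose morphisms $(\gamma,a)\to(\gamma',a')$ are pairs $(u,\alpha)$ with $u:\gamma\to\gamma'$ in $\Gamma$ and $\alpha:A(u)(a)\to a'$ in $A(\gamma')$; it comes with a projection functor to $\Gamma$, and a section is a functor $\Gamma\to\Gamma.A$ whose composite with the projection is the identity. The groupoid $\Gamma.A^\to$ (interpreting the context $\Gamma, x:A, y:A, p:x=_Ay$ in the groupoid model) has objects $(\gamma,a,a',p)$ with $p:a\to a'$ a morphism of $A(\gamma)$, and morphisms $(\gamma,a,a',p)\to(\gamma',b,b',p')$ given by $u:\gamma\to\gamma'$, $\alpha:A(u)(a)\to b$, $\alpha':A(u)(a')\to b'$ with $p'\circ\alpha=\alpha'\circ A(u)(p)$; it has source and target functors to $\Gamma.A$ and a projection to $\Gamma$. The functor $r_A:\Gamma.A\to\Gamma.A^\to$ sends $(\gamma,a)$ to $(\gamma,a,a,1_a)$. -}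

module Defs where

open import Level using (Level; _⊔_) renaming (suc to lsuc)
open import Data.Product using (Σ; _×_; _,_; proj₁; proj₂)
open import Relation.Binary.Core using (Rel)
open import Relation.Binary.Structures using (IsEquivalence)
open import Relation.Binary.PropositionalEquality
  using (_≡_; refl; subst; subst₂; cong)

-- Categories (hom-setoids), raw structure separated from the laws, so
-- that functors can be defined out of the Grothendieck constructions
-- without first proving their category laws (a functor's definition
-- only uses the raw structure of its domain).

record RawCat (o ℓ e : Level) : Set (lsuc (o ⊔ ℓ ⊔ e)) where
  infix  4 _≈_ _⇒_
  infixr 9 _∘_
  field
    Obj : Set o
    _⇒_ : Obj → Obj → Set ℓ
    _≈_ : ∀ {A B} → Rel (A ⇒ B) e
    id  : ∀ {A} → A ⇒ A
    _∘_ : ∀ {A B C} → B ⇒ C → A ⇒ B → A ⇒ C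

record Category (o ℓ e : Level) : Set (lsuc (o ⊔ ℓ ⊔ e)) where
  field
    raw : RawCat o ℓ e
  open RawCat raw public
  field
    equiv     : ∀ {A B} → IsEquivalence (_≈_ {A} {B})
    ∘-resp-≈  : ∀ {A B C} {f h : B ⇒ C} {g i : A ⇒ B} →
                f ≈ h → g ≈ i → f ∘ g ≈ h ∘ i
    assoc     : ∀ {A B C D} {f : A ⇒ B} {g : B ⇒ C} {h : C ⇒ D} →
                (h ∘ g) ∘ f ≈ h ∘ (g ∘ f)
    identityˡ : ∀ {A B} {f : A ⇒ B} → id ∘ f ≈ f
    identityʳ : ∀ {A B} {f : A ⇒ B} → f ∘ id ≈ f

  module Eq {A B} = IsEquivalence (equiv {A} {B})

record Groupoid (o ℓ e : Level) : Set (lsuc (o ⊔ ℓ ⊔ e)) where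
  field
    category : Category o ℓ e
  open Category category public
  field
    _⁻¹    : ∀ {A B} → A ⇒ B → B ⇒ A
    iso-ˡ  : ∀ {A B} (f : A ⇒ B) → (f ⁻¹) ∘ f ≈ id
    iso-ʳ  : ∀ {A B} (f : A ⇒ B) → f ∘ (f ⁻¹) ≈ id

record FunctorData {o ℓ e o′ ℓ′ e′ : Level}
       (C : RawCat o ℓ e) (D : RawCat o′ ℓ′ e′) : Set (o ⊔ ℓ ⊔ o′ ⊔ ℓ′) where
  private
    module C = RawCat C
    module D = RawCat D
  field
    F₀ : C.Obj → D.Obj
    F₁ : ∀ {A B} → A C.⇒ B → F₀ A D.⇒ F₀ B

record Functor {o ℓ e o′ ℓ′ e′ : Level}
       (C : RawCat o ℓ e) (D : RawCat o′ ℓ′ e′) : Set (o ⊔ ℓ ⊔ e ⊔ o′ ⊔ ℓ′ ⊔ e′) where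
  private
    module C = RawCat C
    module D = RawCat D
  field
    dat : FunctorData C D
  open FunctorData dat public
  field
    F-resp-≈     : ∀ {A B} {f g : A C.⇒ B} → f C.≈ g → F₁ f D.≈ F₁ g
    identity     : ∀ {A} → F₁ (C.id {A}) D.≈ D.id
    homomorphism : ∀ {A B X} {f : A C.⇒ B} {g : B C.⇒ X} →
                   F₁ (g C.∘ f) D.≈ F₁ g D.∘ F₁ f

infixr 9 _∘D_
_∘D_ : ∀ {o ℓ e o′ ℓ′ e′ o″ ℓ″ e″}
         {C : RawCat o ℓ e} {D : RawCat o′ ℓ′ e′} {E : RawCat o″ ℓ″ e″} →
       FunctorData D E → FunctorData C D → FunctorData C E
G ∘D F = record { F₀ = λ X → FunctorData.F₀ G (FunctorData.F₀ F X)
                ; F₁ = λ f → FunctorData.F₁ G (FunctorData.F₁ F f) }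

idD : ∀ {o ℓ e} (C : RawCat o ℓ e) → FunctorData C C
idD C = record { F₀ = λ X → X ; F₁ = λ f → f }

record _≡F_ {o ℓ e o′ ℓ′ e′ : Level} {C : RawCat o ℓ e} {D : RawCat o′ ℓ′ e′}
            (F G : FunctorData C D) : Set (o ⊔ ℓ ⊔ o′ ⊔ ℓ′ ⊔ e′) where
  private
    module C = RawCat C
    module D = RawCat D
    module F = FunctorData F
    module G = FunctorData G
  field
    eq₀ : ∀ X → F.F₀ X ≡ G.F₀ X
    eq₁ : ∀ {X Y} (f : X C.⇒ Y) →
          subst₂ D._⇒_ (eq₀ X) (eq₀ Y) (F.F₁ f) D.≈ G.F₁ f

record NatTrans {o ℓ e o′ ℓ′ e′ : Level} {C : RawCat o ℓ e} {D : RawCat o′ ℓ′ e′}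
                (F G : FunctorData C D) : Set (o ⊔ ℓ ⊔ ℓ′ ⊔ e′) where
  private
    module C = RawCat C
    module D = RawCat D
    module F = FunctorData F
    module G = FunctorData G
  field
    η       : ∀ X → F.F₀ X D.⇒ G.F₀ X
    commute : ∀ {X Y} (f : X C.⇒ Y) → η Y D.∘ F.F₁ f D.≈ G.F₁ f D.∘ η X

_∘ʳ_ : ∀ {o ℓ e o′ ℓ′ e′ o″ ℓ″ e″}
         {B : RawCat o″ ℓ″ e″} {C : RawCat o ℓ e} {D : RawCat o′ ℓ′ e′}
         {F G : FunctorData C D} →
       NatTrans F G → (M : FunctorData B C) → NatTrans (F ∘D M) (G ∘D M)
c ∘ʳ M = record { η = λ X → NatTrans.η c (FunctorData.F₀ M X)
                ; commute = λ f → NatTrans.commute c (FunctorData.F₁ M f) }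

IsSection : ∀ {o ℓ e o′ ℓ′ e′} {E : RawCat o ℓ e} {B : RawCat o′ ℓ′ e′} →
            FunctorData E B → FunctorData B E → Set (o′ ⊔ ℓ′ ⊔ e′)
IsSection {B = B} p s = (p ∘D s) ≡F idD B

record SymmetricMonoidalCategory (o ℓ e : Level) : Set (lsuc (o ⊔ ℓ ⊔ e)) where
  field
    category : Category o ℓ e
  open Category category public
  infixr 10 _⊗₀_ _⊗₁_
  field
    _⊗₀_ : Obj → Obj → Obj
    _⊗₁_ : ∀ {A B C D} → A ⇒ B → C ⇒ D → (A ⊗₀ C) ⇒ (B ⊗₀ D)
    ⊗-resp-≈ : ∀ {A B C D} {f f′ : A ⇒ B} {g g′ : C ⇒ D} →
               f ≈ f′ → g ≈ g′ → f ⊗₁ g ≈ f′ ⊗₁ g′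
    ⊗-identity : ∀ {A B} → id {A} ⊗₁ id {B} ≈ id
    ⊗-homomorphism : ∀ {A B C A′ B′ C′} {f : A ⇒ B} {g : B ⇒ C}
                       {f′ : A′ ⇒ B′} {g′ : B′ ⇒ C′} →
                     (g ∘ f) ⊗₁ (g′ ∘ f′) ≈ (g ⊗₁ g′) ∘ (f ⊗₁ f′)
    unit : Obj
    α⇒ : ∀ {A B C} → (A ⊗₀ B) ⊗₀ C ⇒ A ⊗₀ (B ⊗₀ C)
    α⇐ : ∀ {A B C} → A ⊗₀ (B ⊗₀ C) ⇒ (A ⊗₀ B) ⊗₀ C
    α-isoˡ : ∀ {A B C} → α⇐ ∘ α⇒ {A} {B} {C} ≈ id
    α-isoʳ : ∀ {A B C} → α⇒ ∘ α⇐ {A} {B} {C} ≈ id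
    α-natural : ∀ {A B C A′ B′ C′} {f : A ⇒ A′} {g : B ⇒ B′} {h : C ⇒ C′} →
                α⇒ ∘ ((f ⊗₁ g) ⊗₁ h) ≈ (f ⊗₁ (g ⊗₁ h)) ∘ α⇒
    λ⇒ : ∀ {A} → unit ⊗₀ A ⇒ A
    λ⇐ : ∀ {A} → A ⇒ unit ⊗₀ A
    λ-isoˡ : ∀ {A} → λ⇐ ∘ λ⇒ {A} ≈ id
    λ-isoʳ : ∀ {A} → λ⇒ ∘ λ⇐ {A} ≈ id
    λ-natural : ∀ {A B} {f : A ⇒ B} → λ⇒ ∘ (id ⊗₁ f) ≈ f ∘ λ⇒
    ρ⇒ : ∀ {A} → A ⊗₀ unit ⇒ A
    ρ⇐ : ∀ {A} → A ⇒ A ⊗₀ unit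
    ρ-isoˡ : ∀ {A} → ρ⇐ ∘ ρ⇒ {A} ≈ id
    ρ-isoʳ : ∀ {A} → ρ⇒ ∘ ρ⇐ {A} ≈ id
    ρ-natural : ∀ {A B} {f : A ⇒ B} → ρ⇒ ∘ (f ⊗₁ id) ≈ f ∘ ρ⇒
    triangle : ∀ {A B} → (id {A} ⊗₁ λ⇒ {B}) ∘ α⇒ ≈ ρ⇒ ⊗₁ id
    pentagon : ∀ {A B C D} →
               (id {A} ⊗₁ α⇒ {B} {C} {D}) ∘ (α⇒ ∘ (α⇒ ⊗₁ id)) ≈ α⇒ ∘ α⇒
    σ : ∀ {A B} → A ⊗₀ B ⇒ B ⊗₀ A
    σ-natural : ∀ {A B A′ B′} {f : A ⇒ A′} {g : B ⇒ B′} →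
                σ ∘ (f ⊗₁ g) ≈ (g ⊗₁ f) ∘ σ
    σ-involutive : ∀ {A B} → σ {B} {A} ∘ σ {A} {B} ≈ id
    hexagon : ∀ {A B C} →
              α⇒ {B} {C} {A} ∘ (σ {A} {B ⊗₀ C} ∘ α⇒ {A} {B} {C})
              ≈ (id ⊗₁ σ) ∘ (α⇒ ∘ (σ ⊗₁ id))

record GpdFunctor {o ℓ e : Level} (Γ : Groupoid o ℓ e) (o′ ℓ′ e′ : Level)
       : Set (o ⊔ ℓ ⊔ e ⊔ lsuc (o′ ⊔ ℓ′ ⊔ e′)) where
  private
    module Γ = Groupoid Γ
  field
    F₀ : Γ.Obj → Groupoid o′ ℓ′ e′
  fib : Γ.Obj → RawCat o′ ℓ′ e′
  fib γ = Groupoid.raw (F₀ γ)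
  field
    F₁ : ∀ {γ γ′} → γ Γ.⇒ γ′ → Functor (fib γ) (fib γ′)
    F-resp-≈     : ∀ {γ γ′} {u v : γ Γ.⇒ γ′} → u Γ.≈ v →
                   Functor.dat (F₁ u) ≡F Functor.dat (F₁ v)
    identity     : ∀ {γ} → Functor.dat (F₁ (Γ.id {γ})) ≡F idD (fib γ)
    homomorphism : ∀ {γ γ′ γ″} {u : γ Γ.⇒ γ′} {v : γ′ Γ.⇒ γ″} →
                   Functor.dat (F₁ (v Γ.∘ u))
                     ≡F (Functor.dat (F₁ v) ∘D Functor.dat (F₁ u))

≡⇒hom : ∀ {o ℓ e} (C : RawCat o ℓ e) {x y : RawCat.Obj C} → x ≡ y → RawCat._⇒_ C x y
≡⇒hom C refl = RawCat.id C

module Grothendieck {o ℓ e o′ ℓ′ e′ : Level} {Γ : Groupoid o ℓ e}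
                    (A : GpdFunctor Γ o′ ℓ′ e′) where
  private
    module Γ = Groupoid Γ
    module A = GpdFunctor A
    module Fib γ = Groupoid (A.F₀ γ)

  act : ∀ {γ γ′} → γ Γ.⇒ γ′ → Fib.Obj γ → Fib.Obj γ′
  act u = Functor.F₀ (A.F₁ u)

  actm : ∀ {γ γ′} (u : γ Γ.⇒ γ′) {a b : Fib.Obj γ} →
         Fib._⇒_ γ a b → Fib._⇒_ γ′ (act u a) (act u b)
  actm u = Functor.F₁ (A.F₁ u)

  ι : ∀ {γ} (a : Fib.Obj γ) → Fib._⇒_ γ (act Γ.id a) a
  ι {γ} a = ≡⇒hom (A.fib γ) (_≡F_.eq₀ A.identity a)

  θ : ∀ {γ γ′ γ″} (u : γ Γ.⇒ γ′) (v : γ′ Γ.⇒ γ″) (a : Fib.Obj γ) →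
      Fib._⇒_ γ″ (act (v Γ.∘ u) a) (act v (act u a))
  θ {γ″ = γ″} u v a = ≡⇒hom (A.fib γ″) (_≡F_.eq₀ A.homomorphism a)

  tr : ∀ {γ γ′} {u v : γ Γ.⇒ γ′} → u Γ.≈ v → {a : Fib.Obj γ} {b : Fib.Obj γ′} →
       Fib._⇒_ γ′ (act u a) b → Fib._⇒_ γ′ (act v a) b
  tr {γ′ = γ′} p {a} {b} α =
    subst (λ x → Fib._⇒_ γ′ x b) (_≡F_.eq₀ (A.F-resp-≈ p) a) α

  ΓA : RawCat (o ⊔ o′) (ℓ ⊔ ℓ′) (e ⊔ e′)
  ΓA = record
    { Obj = Σ Γ.Obj Fib.Obj
    ; _⇒_ = λ { (γ , a) (γ′ , a′) →
                Σ (γ Γ.⇒ γ′) (λ u → Fib._⇒_ γ′ (act u a) a′) }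
    ; _≈_ = λ { {γ , a} {γ′ , a′} (u , α) (v , β) →
                Σ (u Γ.≈ v) (λ p → Fib._≈_ γ′ (tr p α) β) }
    ; id  = λ { {γ , a} → Γ.id , ι a }
    ; _∘_ = λ { {γ , a} {γ′ , a′} {γ″ , a″} (v , β) (u , α) →
                (v Γ.∘ u) , Fib._∘_ γ″ β (Fib._∘_ γ″ (actm v α) (θ u v a)) }
    }

  πA : FunctorData ΓA Γ.raw
  πA = record { F₀ = proj₁ ; F₁ = proj₁ }

  record ArrObj : Set (o ⊔ o′ ⊔ ℓ′) where
    constructor arrObj
    field
      base : Γ.Obj
      src  : Fib.Obj base
      tgt  : Fib.Obj base
      arr  : Fib._⇒_ base src tgt
  open ArrObj

  record ArrHom (X Y : ArrObj) : Set (ℓ ⊔ ℓ′ ⊔ e′) where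
    constructor arrHom
    field
      u    : base X Γ.⇒ base Y
      α    : Fib._⇒_ (base Y) (act u (src X)) (src Y)
      α′   : Fib._⇒_ (base Y) (act u (tgt X)) (tgt Y)
      comm : Fib._≈_ (base Y) (Fib._∘_ (base Y) (arr Y) α)
                              (Fib._∘_ (base Y) α′ (actm u (arr X)))
  open ArrHom

  private
    transport-square :
      ∀ {γ} {x x′ y y′ : Fib.Obj γ} (e₀ : x ≡ x′) (e₁ : y ≡ y′)
        {f : Fib._⇒_ γ x y} {g : Fib._⇒_ γ x′ y′} →
      Fib._≈_ γ (subst₂ (Fib._⇒_ γ) e₀ e₁ f) g →
      Fib._≈_ γ (Fib._∘_ γ g (≡⇒hom (A.fib γ) e₀))
                (Fib._∘_ γ (≡⇒hom (A.fib γ) e₁) f)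
    transport-square {γ} refl refl h =
      Fib.Eq.trans γ (Fib.identityʳ γ)
        (Fib.Eq.trans γ (Fib.Eq.sym γ h) (Fib.Eq.sym γ (Fib.identityˡ γ)))

    id-comm : (X : ArrObj) →
      Fib._≈_ (base X) (Fib._∘_ (base X) (arr X) (ι (src X)))
                       (Fib._∘_ (base X) (ι (tgt X)) (actm Γ.id (arr X)))
    id-comm (arrObj γ a a′ p) =
      transport-square (_≡F_.eq₀ A.identity a) (_≡F_.eq₀ A.identity a′)
                       (_≡F_.eq₁ A.identity p)

    comp-comm : ∀ {X Y Z} (g : ArrHom Y Z) (f : ArrHom X Y) →
      let γ″ = base Z in
      Fib._≈_ γ″
        (Fib._∘_ γ″ (arr Z) (Fib._∘_ γ″ (α g)
            (Fib._∘_ γ″ (actm (u g) (α f)) (θ (u f) (u g) (src X)))))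
        (Fib._∘_ γ″ (Fib._∘_ γ″ (α′ g)
            (Fib._∘_ γ″ (actm (u g) (α′ f)) (θ (u f) (u g) (tgt X))))
          (actm (u g Γ.∘ u f) (arr X)))
    comp-comm {arrObj γ a a′ p} {arrObj γ′ b b′ q} {arrObj γ″ c c′ r}
              (arrHom v β β′ c₂) (arrHom w α₁ α₁′ c₁) =
      trans (sym assoc)
      (trans (∘-resp-≈ c₂ ≈refl)
      (trans assoc
      (trans (∘-resp-≈ ≈refl (sym assoc))
      (trans (∘-resp-≈ ≈refl (∘-resp-≈ (sym Av.homomorphism) ≈refl))
      (trans (∘-resp-≈ ≈refl (∘-resp-≈ (Av.F-resp-≈ c₁) ≈refl))
      (trans (∘-resp-≈ ≈refl (∘-resp-≈ Av.homomorphism ≈refl))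
      (trans (∘-resp-≈ ≈refl assoc)
      (trans (∘-resp-≈ ≈refl (∘-resp-≈ ≈refl
               (transport-square (_≡F_.eq₀ A.homomorphism a)
                                 (_≡F_.eq₀ A.homomorphism a′)
                                 (_≡F_.eq₁ A.homomorphism p))))
      (trans (∘-resp-≈ ≈refl (sym assoc))
             (sym assoc))))))))))
      where
        open Groupoid (A.F₀ γ″)
        open Eq renaming (refl to ≈refl)
        module Av = Functor (A.F₁ v)

  ΓA→ : RawCat (o ⊔ o′ ⊔ ℓ′) (ℓ ⊔ ℓ′ ⊔ e′) (e ⊔ e′)
  ΓA→ = record
    { Obj = ArrObj
    ; _⇒_ = ArrHom
    ; _≈_ = λ {X} {Y} f g →
              Σ (u f Γ.≈ u g) (λ p → Fib._≈_ (base Y) (tr p (α f)) (α g)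
                                   × Fib._≈_ (base Y) (tr p (α′ f)) (α′ g))
    ; id  = λ {X} → arrHom Γ.id (ι (src X)) (ι (tgt X)) (id-comm X)
    ; _∘_ = λ {X} {Y} {Z} g f →
              arrHom (u g Γ.∘ u f)
                     (Fib._∘_ (base Z) (α g)
                        (Fib._∘_ (base Z) (actm (u g) (α f)) (θ (u f) (u g) (src X))))
                     (Fib._∘_ (base Z) (α′ g)
                        (Fib._∘_ (base Z) (actm (u g) (α′ f)) (θ (u f) (u g) (tgt X))))
                     (comp-comm g f)
    }

  πA→ : FunctorData ΓA→ Γ.raw
  πA→ = record { F₀ = base ; F₁ = u }

  srcA : FunctorData ΓA→ ΓA
  srcA = record { F₀ = λ X → base X , src X ; F₁ = λ f → u f , α f }

  tgtA : FunctorData ΓA→ ΓA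
  tgtA = record { F₀ = λ X → base X , tgt X ; F₁ = λ f → u f , α′ f }

  private
    r-comm : ∀ {γ γ′} {a : Fib.Obj γ} {a′ : Fib.Obj γ′}
               (w : γ Γ.⇒ γ′) (β : Fib._⇒_ γ′ (act w a) a′) →
             Fib._≈_ γ′ (Fib._∘_ γ′ (Fib.id γ′) β)
                        (Fib._∘_ γ′ β (actm w (Fib.id γ)))
    r-comm {γ} {γ′} w β =
      trans identityˡ
        (sym (trans (∘-resp-≈ ≈refl (Functor.identity (A.F₁ w))) identityʳ))
      where
        open Groupoid (A.F₀ γ′)
        open Eq renaming (refl to ≈refl)

  rA : FunctorData ΓA ΓA→
  rA = record
    { F₀ = λ { (γ , a) → arrObj γ a a (Fib.id γ) }
    ; F₁ = λ { (w , β) → arrHom w β β (r-comm w β) }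
    }

module Submission where

-- The natural transformation ĉ is obtained by extending c from the reflexive
-- arrows to the whole of Γ.A→ and then whiskering with P̂.  The extension rests
-- on one observation: every object X = (γ, a, a′, p) of Γ.A→ is isomorphic,
-- naturally in X, to the reflexive arrow r_A(γ, a) = (γ, a, a, 1) through the
-- "contraction"  κ_X = (1, ι, p ∘ ι) : r_A(γ, a) → X,  where ι : A(1)(a) → a is
-- the canonical transport.  Conjugating c by κ gives
--     ĉ_X = C(κ_X) ∘ c_(γ,a) ∘ Ξ(κ_X)⁻¹ ,
-- which is natural in X; on a reflexive arrow κ is the identity, so ĉ agrees
-- with c there.  The construction works for an arbitrary functor P̂.

open import Level using (Level; _⊔_)
open import Data.Product using (Σ; _,_)
open import Relation.Binary.Bundles using (Setoid)
open import Relation.Binary.PropositionalEquality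
  using (_≡_; refl; sym; trans; cong; subst; subst₂)
import Relation.Binary.Reasoning.Setoid as SetoidReasoning
open import Defs

module CategoryLemmas {o ℓ e} (𝒞 : Category o ℓ e) where
  open Category 𝒞 public
  open Eq public using () renaming (refl to ≈-refl; sym to ≈-sym; trans to ≈-trans)

  hom-setoid : Obj → Obj → Setoid ℓ e
  hom-setoid x y = record { Carrier = x ⇒ y ; _≈_ = _≈_ ; isEquivalence = equiv }

  module HomReasoning {x y : Obj} = SetoidReasoning (hom-setoid x y)
  open HomReasoning public

  infixr 4 _⟩∘⟨_ refl⟩∘⟨_
  infixl 5 _⟩∘⟨refl
  _⟩∘⟨_ : ∀ {x y z} {f h : y ⇒ z} {g i : x ⇒ y} → f ≈ h → g ≈ i → f ∘ g ≈ h ∘ i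
  _⟩∘⟨_ = ∘-resp-≈

  refl⟩∘⟨_ : ∀ {x y z} {f : y ⇒ z} {g i : x ⇒ y} → g ≈ i → f ∘ g ≈ f ∘ i
  refl⟩∘⟨ p = ≈-refl ⟩∘⟨ p

  _⟩∘⟨refl : ∀ {x y z} {f h : y ⇒ z} {g : x ⇒ y} → f ≈ h → f ∘ g ≈ h ∘ g
  p ⟩∘⟨refl = p ⟩∘⟨ ≈-refl

  ⟦_⟧ : ∀ {x y} → x ≡ y → x ⇒ y
  ⟦ p ⟧ = ≡⇒hom raw p

  -- transports compose to the transport along any equality (by UIP, all
  -- parallel equalities of objects coincide)
  ⟦⟧-compose : ∀ {x y z} (p : y ≡ z) (q : x ≡ y) (r : x ≡ z) → ⟦ p ⟧ ∘ ⟦ q ⟧ ≈ ⟦ r ⟧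
  ⟦⟧-compose refl refl refl = identityˡ

  ⟦⟧-loop : ∀ {x} (p : x ≡ x) → ⟦ p ⟧ ≈ id
  ⟦⟧-loop refl = ≈-refl

  subst-dom : ∀ {x x′ y} (p : x ≡ x′) (h : x ⇒ y) →
              subst (λ z → z ⇒ y) p h ≈ h ∘ ⟦ sym p ⟧
  subst-dom refl h = ≈-sym identityʳ

  transport-square : ∀ {x x′ y y′} (p : x ≡ x′) (q : y ≡ y′) {f : x ⇒ y} {g : x′ ⇒ y′} →
                     subst₂ _⇒_ p q f ≈ g → g ∘ ⟦ p ⟧ ≈ ⟦ q ⟧ ∘ f
  transport-square refl refl f≈g = ≈-trans identityʳ (≈-trans (≈-sym f≈g) (≈-sym identityˡ))

  conjugate-square : ∀ {a b c d} {k : a ⇒ b} {k⁻¹ : b ⇒ a} {l : c ⇒ d} {l⁻¹ : d ⇒ c}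
                       {f : b ⇒ d} {g : a ⇒ c} →
                     k ∘ k⁻¹ ≈ id → l⁻¹ ∘ l ≈ id → f ∘ k ≈ l ∘ g → l⁻¹ ∘ f ≈ g ∘ k⁻¹
  conjugate-square {k = k} {k⁻¹} {l} {l⁻¹} {f} {g} kk⁻¹ l⁻¹l square = begin
    l⁻¹ ∘ f                  ≈⟨ identityʳ ⟨
    (l⁻¹ ∘ f) ∘ id           ≈⟨ refl⟩∘⟨ kk⁻¹ ⟨
    (l⁻¹ ∘ f) ∘ (k ∘ k⁻¹)    ≈⟨ assoc ⟩
    l⁻¹ ∘ (f ∘ (k ∘ k⁻¹))    ≈⟨ refl⟩∘⟨ assoc ⟨
    l⁻¹ ∘ ((f ∘ k) ∘ k⁻¹)    ≈⟨ refl⟩∘⟨ square ⟩∘⟨refl ⟩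
    l⁻¹ ∘ ((l ∘ g) ∘ k⁻¹)    ≈⟨ refl⟩∘⟨ assoc ⟩
    l⁻¹ ∘ (l ∘ (g ∘ k⁻¹))    ≈⟨ assoc ⟨
    (l⁻¹ ∘ l) ∘ (g ∘ k⁻¹)    ≈⟨ l⁻¹l ⟩∘⟨refl ⟩
    id ∘ (g ∘ k⁻¹)           ≈⟨ identityˡ ⟩
    g ∘ k⁻¹                  ∎

  conjugate-by-identities : ∀ {x y} {f : y ⇒ y} {h : x ⇒ y} {g : x ⇒ x} →
                            f ≈ id → g ≈ id → f ∘ (h ∘ g) ≈ h
  conjugate-by-identities f≈id g≈id =
    ≈-trans (f≈id ⟩∘⟨ refl⟩∘⟨ g≈id) (≈-trans identityˡ identityʳ)

module GroupoidLemmas {o ℓ e} (𝒢 : Groupoid o ℓ e) where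
  open CategoryLemmas (Groupoid.category 𝒢) public
  open Groupoid 𝒢 public using (_⁻¹; iso-ˡ; iso-ʳ)

  cancel-inverseˡ : ∀ {x y z} (p : x ⇒ y) {h : z ⇒ x} → (p ⁻¹) ∘ (p ∘ h) ≈ h
  cancel-inverseˡ p {h} = begin
    (p ⁻¹) ∘ (p ∘ h)  ≈⟨ assoc ⟨
    ((p ⁻¹) ∘ p) ∘ h  ≈⟨ iso-ˡ p ⟩∘⟨refl ⟩
    id ∘ h            ≈⟨ identityˡ ⟩
    h                 ∎

  cancel-inverseʳ : ∀ {x y z} (p : x ⇒ y) {h : z ⇒ y} → p ∘ ((p ⁻¹) ∘ h) ≈ h
  cancel-inverseʳ p {h} = begin
    p ∘ ((p ⁻¹) ∘ h)  ≈⟨ assoc ⟨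
    (p ∘ (p ⁻¹)) ∘ h  ≈⟨ iso-ʳ p ⟩∘⟨refl ⟩
    id ∘ h            ≈⟨ identityˡ ⟩
    h                 ∎

  inverse-of-id : ∀ {x} → (id {x}) ⁻¹ ≈ id
  inverse-of-id = ≈-trans (≈-sym identityʳ) (iso-ˡ id)

record Contraction {oa ℓa ea od ℓd ed : Level} {𝒜 : RawCat oa ℓa ea} {𝒟 : RawCat od ℓd ed}
                   (r : FunctorData 𝒜 𝒟) (s : FunctorData 𝒟 𝒜) : Set (od ⊔ ℓd ⊔ ed) where
  private
    module 𝒟 = RawCat 𝒟
    module r = FunctorData r
    module s = FunctorData s
  field
    κ         : ∀ X → r.F₀ (s.F₀ X) 𝒟.⇒ X
    κ⁻¹       : ∀ X → X 𝒟.⇒ r.F₀ (s.F₀ X)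
    κ∘κ⁻¹     : ∀ X → κ X 𝒟.∘ κ⁻¹ X 𝒟.≈ 𝒟.id
    κ⁻¹∘κ     : ∀ X → κ⁻¹ X 𝒟.∘ κ X 𝒟.≈ 𝒟.id
    κ-natural : ∀ {X Y} (f : X 𝒟.⇒ Y) → f 𝒟.∘ κ X 𝒟.≈ κ Y 𝒟.∘ r.F₁ (s.F₁ f)

module Extension {oa ℓa ea od ℓd ed ov ℓv ev : Level}
                 {𝒜 : RawCat oa ℓa ea} {𝒟 : RawCat od ℓd ed} (𝒱 : Category ov ℓv ev)
                 {r : FunctorData 𝒜 𝒟} {s : FunctorData 𝒟 𝒜} (K : Contraction r s)
                 (Ξ C : Functor 𝒟 (Category.raw 𝒱))
                 (c : NatTrans (Functor.dat Ξ ∘D r) (Functor.dat C ∘D r)) where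
  open CategoryLemmas 𝒱
  open Contraction K
  private
    module 𝒟 = RawCat 𝒟
    module r = FunctorData r
    module s = FunctorData s
    module Ξ = Functor Ξ
    module C = Functor C
    module c = NatTrans c

  module Image (F : Functor 𝒟 (Category.raw 𝒱)) where
    open Functor F

    κ-section : ∀ X → F₁ (κ X) ∘ F₁ (κ⁻¹ X) ≈ id
    κ-section X = ≈-trans (≈-sym homomorphism) (≈-trans (F-resp-≈ (κ∘κ⁻¹ X)) identity)

    κ-retraction : ∀ X → F₁ (κ⁻¹ X) ∘ F₁ (κ X) ≈ id
    κ-retraction X = ≈-trans (≈-sym homomorphism) (≈-trans (F-resp-≈ (κ⁻¹∘κ X)) identity)

    κ-square : ∀ {X Y} (f : X 𝒟.⇒ Y) →
               F₁ f ∘ F₁ (κ X) ≈ F₁ (κ Y) ∘ F₁ (r.F₁ (s.F₁ f))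
    κ-square f = ≈-trans (≈-sym homomorphism) (≈-trans (F-resp-≈ (κ-natural f)) homomorphism)

  private
    module ImΞ = Image Ξ
    module ImC = Image C

  ĉ : ∀ X → Ξ.F₀ X ⇒ C.F₀ X
  ĉ X = C.F₁ (κ X) ∘ (c.η (s.F₀ X) ∘ Ξ.F₁ (κ⁻¹ X))

  ĉ-natural : ∀ {X Y} (f : X 𝒟.⇒ Y) → ĉ Y ∘ Ξ.F₁ f ≈ C.F₁ f ∘ ĉ X
  ĉ-natural {X} {Y} f = begin
    (C.F₁ (κ Y) ∘ (c.η sY ∘ Ξ.F₁ (κ⁻¹ Y))) ∘ Ξ.F₁ f   ≈⟨ ≈-trans assoc (refl⟩∘⟨ assoc) ⟩
    C.F₁ (κ Y) ∘ (c.η sY ∘ (Ξ.F₁ (κ⁻¹ Y) ∘ Ξ.F₁ f))   ≈⟨ refl⟩∘⟨ refl⟩∘⟨ Ξ-square ⟩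
    C.F₁ (κ Y) ∘ (c.η sY ∘ (Ξ.F₁ rsf ∘ Ξ.F₁ (κ⁻¹ X))) ≈⟨ refl⟩∘⟨ assoc ⟨
    C.F₁ (κ Y) ∘ ((c.η sY ∘ Ξ.F₁ rsf) ∘ Ξ.F₁ (κ⁻¹ X)) ≈⟨ refl⟩∘⟨ c.commute (s.F₁ f) ⟩∘⟨refl ⟩
    C.F₁ (κ Y) ∘ ((C.F₁ rsf ∘ c.η sX) ∘ Ξ.F₁ (κ⁻¹ X)) ≈⟨ refl⟩∘⟨ assoc ⟩
    C.F₁ (κ Y) ∘ (C.F₁ rsf ∘ (c.η sX ∘ Ξ.F₁ (κ⁻¹ X))) ≈⟨ assoc ⟨
    (C.F₁ (κ Y) ∘ C.F₁ rsf) ∘ (c.η sX ∘ Ξ.F₁ (κ⁻¹ X)) ≈⟨ ImC.κ-square f ⟩∘⟨refl ⟨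
    (C.F₁ f ∘ C.F₁ (κ X)) ∘ (c.η sX ∘ Ξ.F₁ (κ⁻¹ X))   ≈⟨ assoc ⟩
    C.F₁ f ∘ ĉ X                                      ∎
    where
      sX sY : RawCat.Obj 𝒜
      sX = s.F₀ X
      sY = s.F₀ Y
      rsf : r.F₀ sX 𝒟.⇒ r.F₀ sY
      rsf = r.F₁ (s.F₁ f)
      Ξ-square : Ξ.F₁ (κ⁻¹ Y) ∘ Ξ.F₁ f ≈ Ξ.F₁ rsf ∘ Ξ.F₁ (κ⁻¹ X)
      Ξ-square = conjugate-square (ImΞ.κ-section X) (ImΞ.κ-retraction Y) (ImΞ.κ-square f)

  extend : NatTrans (Functor.dat Ξ) (Functor.dat C)
  extend = record { η = ĉ ; commute = ĉ-natural }

module ArrowContraction {o ℓ e o′ ℓ′ e′ : Level} {Γ : Groupoid o ℓ e}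
                        (A : GpdFunctor Γ o′ ℓ′ e′) where
  open Grothendieck A
  private
    module Γ = Groupoid Γ
    module A = GpdFunctor A
  open module Fibre {γ : Γ.Obj} = GroupoidLemmas (A.F₀ γ)

  A-identity : ∀ {γ} (a : Obj {γ}) → act Γ.id a ≡ a
  A-identity a = _≡F_.eq₀ A.identity a

  A-homomorphism : ∀ {γ γ′ γ″} (u : γ Γ.⇒ γ′) (v : γ′ Γ.⇒ γ″) (a : Obj {γ}) →
                   act (v Γ.∘ u) a ≡ act v (act u a)
  A-homomorphism u v a = _≡F_.eq₀ (A.homomorphism {u = u} {v = v}) a

  A-resp : ∀ {γ γ′} {u v : γ Γ.⇒ γ′} → u Γ.≈ v → (a : Obj {γ}) → act u a ≡ act v a
  A-resp u≈v a = _≡F_.eq₀ (A.F-resp-≈ u≈v) a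

  actm-resp : ∀ {γ γ′} (w : γ Γ.⇒ γ′) {a b : Obj {γ}} {h h′ : a ⇒ b} →
              h ≈ h′ → actm w h ≈ actm w h′
  actm-resp w = Functor.F-resp-≈ (A.F₁ w)

  actm-id : ∀ {γ γ′} (w : γ Γ.⇒ γ′) {a : Obj {γ}} → actm w (id {A = a}) ≈ id
  actm-id w = Functor.identity (A.F₁ w)

  actm-∘ : ∀ {γ γ′} (w : γ Γ.⇒ γ′) {a b c : Obj {γ}} {g : b ⇒ c} {h : a ⇒ b} →
           actm w (g ∘ h) ≈ actm w g ∘ actm w h
  actm-∘ w = Functor.homomorphism (A.F₁ w)

  actm-⟦⟧ : ∀ {γ γ′} (w : γ Γ.⇒ γ′) {a b : Obj {γ}} (p : a ≡ b) →
            actm w ⟦ p ⟧ ≈ ⟦ cong (act w) p ⟧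
  actm-⟦⟧ w refl = actm-id w

  tr-⟦⟧ : ∀ {γ γ′} {u v : γ Γ.⇒ γ′} (q : u Γ.≈ v) {a : Obj {γ}} {b : Obj {γ′}}
          (h : act u a ⇒ b) → tr q h ≈ h ∘ ⟦ sym (A-resp q a) ⟧
  tr-⟦⟧ q {a} h = subst-dom (A-resp q a) h

  tr-resp : ∀ {γ γ′} {u v : γ Γ.⇒ γ′} (q : u Γ.≈ v) {a : Obj {γ}} {b : Obj {γ′}}
            {h h′ : act u a ⇒ b} → h ≈ h′ → tr q h ≈ tr q h′
  tr-resp q h≈h′ = ≈-trans (tr-⟦⟧ q _) (≈-trans (h≈h′ ⟩∘⟨refl) (≈-sym (tr-⟦⟧ q _)))

  tr-postcompose : ∀ {γ γ′} {u v : γ Γ.⇒ γ′} (q : u Γ.≈ v) {a : Obj {γ}} {b c : Obj {γ′}}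
                   (g : b ⇒ c) (h : act u a ⇒ b) → tr q (g ∘ h) ≈ g ∘ tr q h
  tr-postcompose q g h =
    ≈-trans (tr-⟦⟧ q _) (≈-trans assoc (refl⟩∘⟨ ≈-sym (tr-⟦⟧ q h)))

  tr-refl : ∀ {γ γ′} {u : γ Γ.⇒ γ′} {a : Obj {γ}} {b : Obj {γ′}} (h : act u a ⇒ b) →
            tr Γ.Eq.refl h ≈ h
  tr-refl {u = u} {a} h =
    ≈-trans (tr-⟦⟧ Γ.Eq.refl h)
            (≈-trans (refl⟩∘⟨ ⟦⟧-loop (sym (A-resp (Γ.Eq.refl {x = u}) a))) identityʳ)

  ι-natural : ∀ {γ} {a b : Obj {γ}} (h : a ⇒ b) → ι b ∘ actm Γ.id h ≈ h ∘ ι a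
  ι-natural {a = a} {b} h =
    ≈-sym (transport-square (A-identity a) (A-identity b) (_≡F_.eq₁ A.identity h))

  -- unit law of the composite  ι ∘ A(1)(ι) ∘ θ  appearing in  κ ∘ κ⁻¹  and  κ⁻¹ ∘ κ;
  -- every morphism involved is a transport, so this is an instance of UIP
  ι-unit : ∀ {γ} (a : Obj {γ}) →
           tr Γ.identityˡ (ι a ∘ (actm Γ.id (ι a) ∘ θ Γ.id Γ.id a)) ≈ ι a
  ι-unit a = begin
    tr Γ.identityˡ (ι a ∘ (actm Γ.id (ι a) ∘ θ Γ.id Γ.id a))
      ≈⟨ tr-⟦⟧ Γ.identityˡ _ ⟩
    (⟦ ida ⟧ ∘ (actm Γ.id ⟦ ida ⟧ ∘ ⟦ hom ⟧)) ∘ ⟦ back ⟧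
      ≈⟨ (refl⟩∘⟨ actm-⟦⟧ Γ.id ida ⟩∘⟨refl) ⟩∘⟨refl ⟩
    (⟦ ida ⟧ ∘ (⟦ A1-ida ⟧ ∘ ⟦ hom ⟧)) ∘ ⟦ back ⟧
      ≈⟨ (refl⟩∘⟨ ⟦⟧-compose A1-ida hom inner) ⟩∘⟨refl ⟩
    (⟦ ida ⟧ ∘ ⟦ inner ⟧) ∘ ⟦ back ⟧
      ≈⟨ ⟦⟧-compose ida inner (trans inner ida) ⟩∘⟨refl ⟩
    ⟦ trans inner ida ⟧ ∘ ⟦ back ⟧
      ≈⟨ ⟦⟧-compose (trans inner ida) back ida ⟩
    ⟦ ida ⟧
      ∎
    where
      ida : act Γ.id a ≡ a
      ida = A-identity a
      A1-ida : act Γ.id (act Γ.id a) ≡ act Γ.id a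
      A1-ida = cong (act Γ.id) ida
      hom : act (Γ.id Γ.∘ Γ.id) a ≡ act Γ.id (act Γ.id a)
      hom = A-homomorphism Γ.id Γ.id a
      inner : act (Γ.id Γ.∘ Γ.id) a ≡ act Γ.id a
      inner = trans hom A1-ida
      back : act Γ.id a ≡ act (Γ.id Γ.∘ Γ.id) a
      back = sym (A-resp Γ.identityˡ a)

  swap-unit : ∀ {γ γ′} (w : γ Γ.⇒ γ′) → w Γ.∘ Γ.id Γ.≈ Γ.id Γ.∘ w
  swap-unit w = Γ.Eq.trans Γ.identityʳ (Γ.Eq.sym Γ.identityˡ)

  -- the two unit constraints  A(w)(ι) ∘ θ  and  ι ∘ θ  of A agree up to
  -- w ∘ 1 ≈ 1 ∘ w  (again all morphisms involved are transports)
  unit-coherence : ∀ {γ γ′} (w : γ Γ.⇒ γ′) (a : Obj {γ}) →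
                   tr (swap-unit w) (actm w (ι a) ∘ θ Γ.id w a) ≈ ι (act w a) ∘ θ w Γ.id a
  unit-coherence w a = begin
    tr (swap-unit w) (actm w (ι a) ∘ θ Γ.id w a)
      ≈⟨ tr-⟦⟧ (swap-unit w) _ ⟩
    (actm w ⟦ A-identity a ⟧ ∘ ⟦ hom-right ⟧) ∘ ⟦ back ⟧
      ≈⟨ actm-⟦⟧ w (A-identity a) ⟩∘⟨refl ⟩∘⟨refl ⟩
    (⟦ Aw-ida ⟧ ∘ ⟦ hom-right ⟧) ∘ ⟦ back ⟧
      ≈⟨ ⟦⟧-compose Aw-ida hom-right right ⟩∘⟨refl ⟩
    ⟦ right ⟧ ∘ ⟦ back ⟧
      ≈⟨ ⟦⟧-compose right back left ⟩
    ⟦ left ⟧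
      ≈⟨ ⟦⟧-compose (A-identity (act w a)) hom-left left ⟨
    ⟦ A-identity (act w a) ⟧ ∘ ⟦ hom-left ⟧
      ∎
    where
      hom-right : act (w Γ.∘ Γ.id) a ≡ act w (act Γ.id a)
      hom-right = A-homomorphism Γ.id w a
      hom-left : act (Γ.id Γ.∘ w) a ≡ act Γ.id (act w a)
      hom-left = A-homomorphism w Γ.id a
      Aw-ida : act w (act Γ.id a) ≡ act w a
      Aw-ida = cong (act w) (A-identity a)
      right : act (w Γ.∘ Γ.id) a ≡ act w a
      right = trans hom-right Aw-ida
      left : act (Γ.id Γ.∘ w) a ≡ act w a
      left = trans hom-left (A-identity (act w a))
      back : act (Γ.id Γ.∘ w) a ≡ act (w Γ.∘ Γ.id) a
      back = sym (A-resp (swap-unit w) a)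

  unit-square : ∀ {γ γ′} (w : γ Γ.⇒ γ′) {a : Obj {γ}} {b : Obj {γ′}} (β : act w a ⇒ b) →
                tr (swap-unit w) (β ∘ (actm w (ι a) ∘ θ Γ.id w a))
                  ≈ ι b ∘ (actm Γ.id β ∘ θ w Γ.id a)
  unit-square w {a} {b} β = begin
    tr (swap-unit w) (β ∘ (actm w (ι a) ∘ θ Γ.id w a))  ≈⟨ tr-postcompose (swap-unit w) β _ ⟩
    β ∘ tr (swap-unit w) (actm w (ι a) ∘ θ Γ.id w a)    ≈⟨ refl⟩∘⟨ unit-coherence w a ⟩
    β ∘ (ι (act w a) ∘ θ w Γ.id a)                      ≈⟨ assoc ⟨
    (β ∘ ι (act w a)) ∘ θ w Γ.id a                      ≈⟨ ι-natural β ⟩∘⟨refl ⟨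
    (ι b ∘ actm Γ.id β) ∘ θ w Γ.id a                    ≈⟨ assoc ⟩
    ι b ∘ (actm Γ.id β ∘ θ w Γ.id a)                    ∎

  infix  4 _≈→_
  infixr 9 _∘→_

  _≈→_ : ∀ {X Y : ArrObj} → ArrHom X Y → ArrHom X Y → Set (e ⊔ e′)
  _≈→_ = RawCat._≈_ ΓA→

  _∘→_ : ∀ {X Y Z : ArrObj} → ArrHom Y Z → ArrHom X Y → ArrHom X Z
  _∘→_ = RawCat._∘_ ΓA→

  id→ : ∀ {X : ArrObj} → ArrHom X X
  id→ = RawCat.id ΓA→

  reflexive : ArrObj → ArrObj
  reflexive = FunctorData.F₀ (rA ∘D srcA)

  contract : (X : ArrObj) → ArrHom (reflexive X) X
  contract (arrObj γ a a′ p) = arrHom Γ.id (ι a) (p ∘ ι a) square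
    where
      square : p ∘ ι a ≈ (p ∘ ι a) ∘ actm Γ.id id
      square = ≈-sym (≈-trans (refl⟩∘⟨ actm-id Γ.id) identityʳ)

  expand : (X : ArrObj) → ArrHom X (reflexive X)
  expand (arrObj γ a a′ p) = arrHom Γ.id (ι a) (ι a ∘ actm Γ.id (p ⁻¹)) square
    where
      square : id ∘ ι a ≈ (ι a ∘ actm Γ.id (p ⁻¹)) ∘ actm Γ.id p
      square = begin
        id ∘ ι a                                   ≈⟨ ≈-trans identityˡ (≈-sym identityʳ) ⟩
        ι a ∘ id                                   ≈⟨ refl⟩∘⟨ actm-id Γ.id ⟨
        ι a ∘ actm Γ.id id                         ≈⟨ refl⟩∘⟨ actm-resp Γ.id (iso-ˡ p) ⟨
        ι a ∘ actm Γ.id ((p ⁻¹) ∘ p)               ≈⟨ refl⟩∘⟨ actm-∘ Γ.id ⟩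
        ι a ∘ (actm Γ.id (p ⁻¹) ∘ actm Γ.id p)     ≈⟨ assoc ⟨
        (ι a ∘ actm Γ.id (p ⁻¹)) ∘ actm Γ.id p     ∎

  -- κ and κ⁻¹ are mutually inverse: the source components are ι-unit, and the
  -- target components reduce to ι-unit after cancelling p against p⁻¹
  contract-expand : ∀ X → contract X ∘→ expand X ≈→ id→
  contract-expand (arrObj γ a a′ p) =
    Γ.identityˡ , ι-unit a , ≈-trans (tr-resp Γ.identityˡ target) (ι-unit a′)
    where
      target : (p ∘ ι a) ∘ (actm Γ.id (ι a ∘ actm Γ.id (p ⁻¹)) ∘ θ Γ.id Γ.id a′)
               ≈ ι a′ ∘ (actm Γ.id (ι a′) ∘ θ Γ.id Γ.id a′)
      target = begin
        (p ∘ ι a) ∘ (actm Γ.id (ι a ∘ actm Γ.id (p ⁻¹)) ∘ θ Γ.id Γ.id a′)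
          ≈⟨ refl⟩∘⟨ actm-resp Γ.id (ι-natural (p ⁻¹)) ⟩∘⟨refl ⟩
        (p ∘ ι a) ∘ (actm Γ.id ((p ⁻¹) ∘ ι a′) ∘ θ Γ.id Γ.id a′)
          ≈⟨ refl⟩∘⟨ ≈-trans (actm-∘ Γ.id ⟩∘⟨refl) assoc ⟩
        (p ∘ ι a) ∘ (actm Γ.id (p ⁻¹) ∘ (actm Γ.id (ι a′) ∘ θ Γ.id Γ.id a′))
          ≈⟨ ≈-trans (≈-sym assoc ⟩∘⟨refl) assoc ⟨
        (p ∘ (ι a ∘ actm Γ.id (p ⁻¹))) ∘ (actm Γ.id (ι a′) ∘ θ Γ.id Γ.id a′)
          ≈⟨ (refl⟩∘⟨ ι-natural (p ⁻¹)) ⟩∘⟨refl ⟩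
        (p ∘ ((p ⁻¹) ∘ ι a′)) ∘ (actm Γ.id (ι a′) ∘ θ Γ.id Γ.id a′)
          ≈⟨ cancel-inverseʳ p ⟩∘⟨refl ⟩
        ι a′ ∘ (actm Γ.id (ι a′) ∘ θ Γ.id Γ.id a′)
          ∎

  expand-contract : ∀ X → expand X ∘→ contract X ≈→ id→
  expand-contract (arrObj γ a a′ p) =
    Γ.identityˡ , ι-unit a , ≈-trans (tr-resp Γ.identityˡ target) (ι-unit a)
    where
      target : (ι a ∘ actm Γ.id (p ⁻¹)) ∘ (actm Γ.id (p ∘ ι a) ∘ θ Γ.id Γ.id a)
               ≈ ι a ∘ (actm Γ.id (ι a) ∘ θ Γ.id Γ.id a)
      target = begin
        (ι a ∘ actm Γ.id (p ⁻¹)) ∘ (actm Γ.id (p ∘ ι a) ∘ θ Γ.id Γ.id a)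
          ≈⟨ ≈-trans assoc (refl⟩∘⟨ ≈-sym assoc) ⟩
        ι a ∘ ((actm Γ.id (p ⁻¹) ∘ actm Γ.id (p ∘ ι a)) ∘ θ Γ.id Γ.id a)
          ≈⟨ refl⟩∘⟨ actm-∘ Γ.id ⟩∘⟨refl ⟨
        ι a ∘ (actm Γ.id ((p ⁻¹) ∘ (p ∘ ι a)) ∘ θ Γ.id Γ.id a)
          ≈⟨ refl⟩∘⟨ actm-resp Γ.id (cancel-inverseˡ p) ⟩∘⟨refl ⟩
        ι a ∘ (actm Γ.id (ι a) ∘ θ Γ.id Γ.id a)
          ∎

  -- κ is natural,  f ∘ κ_X ≈ κ_Y ∘ r_A(src f):  the source component is
  -- unit-square, the target one reduces to it through the square of f
  contract-natural : ∀ {X Y} (f : ArrHom X Y) →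
                     f ∘→ contract X ≈→ contract Y ∘→ FunctorData.F₁ (rA ∘D srcA) f
  contract-natural {arrObj γ a a′ p} {arrObj γ′ b b′ q} (arrHom w β β′ comm) =
    swap-unit w , unit-square w β , target
    where
      target : tr (swap-unit w) (β′ ∘ (actm w (p ∘ ι a) ∘ θ Γ.id w a))
               ≈ (q ∘ ι b) ∘ (actm Γ.id β ∘ θ w Γ.id a)
      target = begin
        tr (swap-unit w) (β′ ∘ (actm w (p ∘ ι a) ∘ θ Γ.id w a))
          ≈⟨ tr-resp (swap-unit w) (refl⟩∘⟨ ≈-trans (actm-∘ w ⟩∘⟨refl) assoc) ⟩
        tr (swap-unit w) (β′ ∘ (actm w p ∘ (actm w (ι a) ∘ θ Γ.id w a)))
          ≈⟨ tr-resp (swap-unit w) (≈-trans (≈-sym assoc) (≈-trans (≈-sym comm ⟩∘⟨refl) assoc)) ⟩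
        tr (swap-unit w) (q ∘ (β ∘ (actm w (ι a) ∘ θ Γ.id w a)))
          ≈⟨ tr-postcompose (swap-unit w) q _ ⟩
        q ∘ tr (swap-unit w) (β ∘ (actm w (ι a) ∘ θ Γ.id w a))
          ≈⟨ refl⟩∘⟨ unit-square w β ⟩
        q ∘ (ι b ∘ (actm Γ.id β ∘ θ w Γ.id a))
          ≈⟨ assoc ⟨
        (q ∘ ι b) ∘ (actm Γ.id β ∘ θ w Γ.id a)
          ∎

  contract-on-reflexive : ∀ γ (a : Obj {γ}) → contract (arrObj γ a a id) ≈→ id→
  contract-on-reflexive γ a =
    Γ.Eq.refl , tr-refl (ι a) , ≈-trans (tr-refl (id ∘ ι a)) identityˡ

  expand-on-reflexive : ∀ γ (a : Obj {γ}) → expand (arrObj γ a a id) ≈→ id→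
  expand-on-reflexive γ a =
    Γ.Eq.refl , tr-refl (ι a) ,
    ≈-trans (tr-refl (ι a ∘ actm Γ.id (id ⁻¹)))
            (≈-trans (refl⟩∘⟨ ≈-trans (actm-resp Γ.id inverse-of-id) (actm-id Γ.id)) identityʳ)

  contraction : Contraction rA srcA
  contraction = record
    { κ         = contract
    ; κ⁻¹       = expand
    ; κ∘κ⁻¹     = contract-expand
    ; κ⁻¹∘κ     = expand-contract
    ; κ-natural = contract-natural
    }

  module _ {ov ℓv ev : Level} (𝒱 : Category ov ℓv ev) (Ξ C : Functor ΓA→ (Category.raw 𝒱))
           (c : NatTrans (Functor.dat Ξ ∘D rA) (Functor.dat C ∘D rA)) where
    private
      module 𝒱 = CategoryLemmas 𝒱
      module Ξ = Functor Ξ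
      module C = Functor C
    open Extension 𝒱 contraction Ξ C c

    extend-on-reflexive : ∀ {X} (Z : RawCat.Obj ΓA) (e : X ≡ FunctorData.F₀ rA Z) →
                          subst₂ 𝒱._⇒_ (cong Ξ.F₀ e) (cong C.F₀ e) (NatTrans.η extend X)
                            𝒱.≈ NatTrans.η c Z
    extend-on-reflexive (γ , a) refl =
      𝒱.conjugate-by-identities
        (𝒱.≈-trans (C.F-resp-≈ (contract-on-reflexive γ a)) C.identity)
        (𝒱.≈-trans (Ξ.F-resp-≈ (expand-on-reflexive γ a)) Ξ.identity)

mainTheorem5 :
  ∀ {o ℓ e o′ ℓ′ e′ o″ ℓ″ e″}
    (V : SymmetricMonoidalCategory o″ ℓ″ e″)
    (Γ : Groupoid o ℓ e) (A : GpdFunctor Γ o′ ℓ′ e′) →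
  let open Grothendieck A
      𝒱 = SymmetricMonoidalCategory.raw V
  in
  (C Ξ : Functor ΓA→ 𝒱)
  (M N : Functor (Groupoid.raw Γ) ΓA) →
  IsSection πA (Functor.dat M) →
  IsSection πA (Functor.dat N) →
  (P̂ : Functor (Groupoid.raw Γ) ΓA→) →
  IsSection πA→ (Functor.dat P̂) →
  (srcA ∘D Functor.dat P̂) ≡F Functor.dat M →
  (tgtA ∘D Functor.dat P̂) ≡F Functor.dat N →
  (c : NatTrans (Functor.dat Ξ ∘D rA) (Functor.dat C ∘D rA)) →
  Σ (NatTrans (Functor.dat Ξ ∘D Functor.dat P̂) (Functor.dat C ∘D Functor.dat P̂))
    (λ ĉ →
      Functor.dat N ≡F Functor.dat M →
      (eqP : Functor.dat P̂ ≡F (rA ∘D Functor.dat M)) →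
      ∀ γ →
        SymmetricMonoidalCategory._≈_ V
          (subst₂ (SymmetricMonoidalCategory._⇒_ V)
             (cong (Functor.F₀ Ξ) (_≡F_.eq₀ eqP γ))
             (cong (Functor.F₀ C) (_≡F_.eq₀ eqP γ))
             (NatTrans.η ĉ γ))
          (NatTrans.η (c ∘ʳ Functor.dat M) γ))
mainTheorem5 {o″ = o″} {ℓ″} {e″} V Γ A C Ξ M _ _ _ P̂ _ _ _ c =
  extend ∘ʳ Functor.dat P̂ ,
  λ _ P̂≡rM γ → extend-on-reflexive 𝒱 Ξ C c (Functor.F₀ M γ) (_≡F_.eq₀ P̂≡rM γ)
  where
    𝒱 : Category o″ ℓ″ e″
    𝒱 = SymmetricMonoidalCategory.category V
    open ArrowContraction A using (contraction; extend-on-reflexive)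
    open Extension 𝒱 contraction Ξ C c using (extend)
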